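{- Let $\omega$ be a positive integer divisible by $7$, let $\sigma$ be a request sequence in the cellular network, and fix an optimal offline feasible assignment for $\sigma$. For each cell $C_i$ let $O_i$ be the number of requests in $C_i$ accepted by the optimal assignment and $A_i$ the number accepted in $C_i$ by CACO run on $\sigma$. Call $C_i$ safe if $O_i\le 2\omega/3$ and dangerous otherwise, and define $$B_i=\begin{cases} 3O_i/7 & \text{if } C_i \text{ is safe},\\ A_i+\frac13\sum_{k}\big(A_k-3O_k/7\big) & \text{if } C_i \text{ is dangerous},\end{cases}$$ where the sum runs over the six neighbors $C_k$ of $C_i$. Then $\sum_i B_i\le \sum_i A_i$, the sums ranging over all cells.
   Context: The cellular network is the infinite tiling of the plane by regular hexagons (cells); two cells are neighbors if they share an edge, so each cell has 6 neighbors. Fix a proper 3-coloring of the cells with colors $R,G,B$. There are $\omega$ frequencies $\{1,\dots,\omega\}$. A request sequence is a finite sequence of cells at which call requests arrive one at a time. An online algorithm must immediately reject each request or accept it by assigning a frequency, such that two accepted calls in the same cell or in neighboring cells never have the same frequency; calls never terminate and frequencies are never changed. An optimal offline feasible assignment is a conflict-free assignment of frequencies to a maximum-size subset of the requests. Algorithm CACO: partition the frequencies into $F_R=\{1,\dots,2\omega/7\}$, $F_G=\{2\omega/7+1,\dots,4\omega/7\}$, $F_B=\{4\omega/7+1,\dots,6\omega/7\}$, $F_S=\{6\omega/7+1,\dots,\omega\}$. When a request arrives at a cell $C$ of color $c$: if some frequency of $F_c$ is not yet used in $C$, assign the smallest such frequency; otherwise, if some frequency of $F_S$ is used neither in $C$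 nor in any neighbor of $C$, assign the smallest such frequency; otherwise reject. (Cells with no requests have $O_i=A_i=B_i=0$, so the sums are finite.) -}

module Defs where

open import Data.Nat as ℕ using (ℕ; zero; suc; _≤ᵇ_; _≤_)
open import Data.Nat.DivMod using (_/_)
open import Data.Integer as ℤ using (ℤ; +_; -[1+_])
open import Data.Integer.Properties using () renaming (_≟_ to _≟ℤ_)
open import Data.Rational as ℚ using (ℚ; 0ℚ)
open import Data.Fin as Fin using (Fin; toℕ)
open import Data.Bool using (Bool; true; false; _∧_; _∨_; not; if_then_else_)
open import Data.Maybe using (Maybe; just; nothing; is-just)
open import Data.Product using (_×_; _,_; proj₁; proj₂)
open import Data.Bool.ListAction using (any)
open import Data.List using (List; []; _∷_; map; upTo; allFin; length; lookup; foldr; _++_)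
open import Relation.Nullary.Decidable using (⌊_⌋)
open import Relation.Binary.PropositionalEquality using (_≡_; _≢_)

-- The cellular network: hexagonal cells in axial coordinates (q , r).
-- The six neighbours of (q , r) are (q±1 , r), (q , r±1), (q+1 , r-1), (q-1 , r+1).

Cell : Set
Cell = ℤ × ℤ

_==_ : Cell → Cell → Bool
(a , b) == (c , d) = ⌊ a ≟ℤ c ⌋ ∧ ⌊ b ≟ℤ d ⌋

neighbours : Cell → List Cell
neighbours (q , r) =
  (q ℤ.+ ℤ.1ℤ , r) ∷ (q ℤ.- ℤ.1ℤ , r) ∷ (q , r ℤ.+ ℤ.1ℤ) ∷ (q , r ℤ.- ℤ.1ℤ) ∷
  (q ℤ.+ ℤ.1ℤ , r ℤ.- ℤ.1ℤ) ∷ (q ℤ.- ℤ.1ℤ , r ℤ.+ ℤ.1ℤ) ∷ []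

adjᵇ : Cell → Cell → Bool
adjᵇ a b = any (λ x → x == b) (neighbours a)

Adjacent : Cell → Cell → Set
Adjacent a b = adjᵇ a b ≡ true

-- A proper 3-colouring (colours R , G , B = 0 , 1 , 2).
ProperColouring : (Cell → Fin 3) → Set
ProperColouring col = ∀ a b → Adjacent a b → col a ≢ col b

-- Algorithm CACO.  A state is the list of accepted calls (cell , frequency).

State : Set
State = List (Cell × ℕ)

usedIn : State → Cell → ℕ → Bool
usedIn s c f = any (λ p → (proj₁ p == c) ∧ ⌊ proj₂ p ℕ.≟ f ⌋) s

firstSat : (ℕ → Bool) → List ℕ → Maybe ℕ
firstSat P [] = nothing
firstSat P (x ∷ xs) = if P x then just x else firstSat P xs

-- F_c for colour c (index 0,1,2 = R,G,B): {2cω/7 + 1, …, 2(c+1)ω/7}, increasing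
Fcol : ℕ → Fin 3 → List ℕ
Fcol ω c = map (λ i → 2 ℕ.* toℕ c ℕ.* (ω / 7) ℕ.+ suc i) (upTo (2 ℕ.* (ω / 7)))

-- F_S = {6ω/7 + 1, …, ω}, increasing
FS : ℕ → List ℕ
FS ω = map (λ i → 6 ℕ.* (ω / 7) ℕ.+ suc i) (upTo (ω ℕ.∸ 6 ℕ.* (ω / 7)))

cacoStep : ℕ → (Cell → Fin 3) → State → Cell → Maybe ℕ
cacoStep ω col s c with firstSat (λ f → not (usedIn s c f)) (Fcol ω (col c))
... | just f = just f
... | nothing =
  firstSat (λ f → not (usedIn s c f ∨ any (λ n → usedIn s n f) (neighbours c))) (FS ω)

cacoRun : ℕ → (Cell → Fin 3) → State → List Cell → State
cacoRun ω col s [] = s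
cacoRun ω col s (c ∷ σ) with cacoStep ω col s c
... | just f  = cacoRun ω col (s ++ ((c , f) ∷ [])) σ
... | nothing = cacoRun ω col s σ

countCell : State → Cell → ℕ
countCell s c = foldr (λ p n → if proj₁ p == c then suc n else n) 0 s

A : ℕ → (Cell → Fin 3) → List Cell → Cell → ℕ
A ω col σ c = countCell (cacoRun ω col [] σ) c

-- Offline assignments: each request i is rejected (nothing) or given a frequency.

Assignment : List Cell → Set
Assignment σ = Fin (length σ) → Maybe ℕ

Feasible : ℕ → (σ : List Cell) → Assignment σ → Set
Feasible ω σ asg =
  (∀ i f → asg i ≡ just f → 1 ≤ f × f ≤ ω) ×
  (∀ i j f → i ≢ j → asg i ≡ just f → asg j ≡ just f →
     lookup σ i ≢ lookup σ j × ¬Adj (lookup σ i) (lookup σ j))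
  where
  ¬Adj : Cell → Cell → Set
  ¬Adj a b = adjᵇ a b ≡ false

sumℕ : List ℕ → ℕ
sumℕ = foldr ℕ._+_ 0

size : (σ : List Cell) → Assignment σ → ℕ
size σ asg = sumℕ (map (λ i → if is-just (asg i) then 1 else 0) (allFin (length σ)))

Optimal : ℕ → (σ : List Cell) → Assignment σ → Set
Optimal ω σ asg = Feasible ω σ asg × (∀ asg' → Feasible ω σ asg' → size σ asg' ≤ size σ asg)

O : (σ : List Cell) → Assignment σ → Cell → ℕ
O σ asg c = sumℕ (map (λ i → if is-just (asg i) ∧ (lookup σ i == c) then 1 else 0)
                      (allFin (length σ)))

ℕ→ℚ : ℕ → ℚ
ℕ→ℚ n = (+ n) ℚ./ 1

sumℚ : List ℚ → ℚ
sumℚ = foldr ℚ._+_ 0ℚ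

safeᵇ : ℕ → ℕ → Bool
safeᵇ ω o = ℕ→ℚ o ℚ.≤ᵇ ((+ (2 ℕ.* ω)) ℚ./ 3)

B : ℕ → (Cell → Fin 3) → (σ : List Cell) → Assignment σ → Cell → ℚ
B ω col σ asg c =
  if safeᵇ ω (O σ asg c)
  then (+ (3 ℕ.* O σ asg c)) ℚ./ 7
  else ℕ→ℚ (A ω col σ c) ℚ.+
       (1ℤ/3 ℚ.* sumℚ (map (λ k → ℕ→ℚ (A ω col σ k) ℚ.- (+ (3 ℕ.* O σ asg k)) ℚ./ 7)
                           (neighbours c)))
  where
  1ℤ/3 : ℚ
  1ℤ/3 = (+ 1) ℚ./ 3

module Submission where

-- Everything is multiplied by 21 so that the inequality lives in ℕ.  With the surplus
-- y_k = 7·A_k − 3·O_k of a cell, 21·B_c is 9·O_c for a safe cell and 21·A_c + Σ_{k~c} y_k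
-- for a dangerous one.  Three facts about the network drive the argument:
--   * adjacent cells share the spectrum, so O_a + O_b ≤ ω; hence no two adjacent cells
--     are dangerous (AdjacentLoad);
--   * CACO rejects a call only in a cell whose band of 2ω/7 frequencies is full, so
--     A_k ≥ min(requests at k, 2ω/7) and on a safe cell 3·O_k ≤ 7·A_k (CACO);
--   * the six neighbours of a cell form three adjacent pairs, so a cell has at most three
--     dangerous neighbours, and a dangerous cell has none (geometry).
-- Charging the surplus of each safe cell to its dangerous neighbours — a double count,
-- reindexed along the six directions — gives Σ 21·B_c ≤ 21·Σ A_c (Charging); dividing
-- by 21 in ℚ gives the theorem.

module CACOAnalysis where

  open import Data.Bool using (Bool; true; false; _∧_; not; if_then_else_)
  open import Data.Bool.ListAction using (any)
  open import Data.Bool.Properties using (T-≡; T-∧; not-involutive; ¬-not)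
  open import Data.Empty using (⊥; ⊥-elim)
  open import Data.Fin using (Fin; toℕ)
  open import Data.Integer as ℤ using (ℤ)
  import Data.Integer.Properties as ℤP
  open import Data.Integer.Tactic.RingSolver using (solve-∀)
  open import Data.List using (List; []; _∷_; _++_; map; length; upTo; lookup; allFin)
  open import Data.List.Membership.Propositional using (_∈_; find)
  open import Data.List.Membership.Propositional.Properties using (∈-map⁺; ∈-map⁻; ∈-upTo⁺)
  open import Data.List.Properties using (length-map; length-upTo; map-tabulate; tabulate-lookup)
  open import Data.List.Relation.Unary.All as All using (All; []; _∷_)
  open import Data.List.Relation.Unary.AllPairs using ([]; _∷_)
  open import Data.List.Relation.Unary.Any as Any using (here; there)
  open import Data.List.Relation.Unary.Any.Properties using (any⁺; any⁻)
  open import Data.List.Relation.Unary.Unique.Propositional using (Unique)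
  open import Data.List.Relation.Unary.Unique.Propositional.Properties using (allFin⁺; map⁺; upTo⁺)
  open import Data.Maybe using (just; nothing; is-just)
  open import Data.Nat as ℕ using (ℕ; zero; suc; _+_; _*_; _∸_; _≤_; _<_; z≤n; s≤s)
  open import Data.Nat.DivMod using (m*n/n≡m)
  import Data.Nat.Properties as ℕP
  import Data.Nat.Tactic.RingSolver as ℕ-Solver
  open import Data.Product using (_×_; _,_; proj₁; proj₂; ∃-syntax)
  open import Data.Rational as ℚ using (ℚ; toℚᵘ)
  import Data.Rational.Properties as ℚP
  open import Data.Rational.Solver using () renaming (module +-*-Solver to ℚ-Solver)
  open import Data.Rational.Unnormalised as ℚᵘ using (mkℚᵘ; _≃_; *≡*; *≤*)
  import Data.Rational.Unnormalised.Properties as ℚᵘP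
  open import Data.Sum using (_⊎_; inj₁; inj₂; [_,_]′)
  open import Function using (_∘_; case_of_; Equivalence; _⇔_; mk⇔)
  open import Relation.Binary.Definitions using (DecidableEquality)
  open import Relation.Binary.PropositionalEquality
  open import Relation.Nullary using (yes; no)
  open import Relation.Nullary.Decidable using (⌊_⌋; does; proof; toWitness; map′; _×-dec_; dec-true; isYes≗does)
  open import Relation.Nullary.Reflects using (Reflects; invert)

  open import Algebra.Properties.CommutativeSemigroup ℕP.+-commutativeSemigroup
    using () renaming (interchange to +-interchange; x∙yz≈y∙xz to +-left-comm)

  open import Defs

  ∑ : {X : Set} → List X → (X → ℕ) → ℕ
  ∑ L f = sumℕ (map f L)

  module _ {X : Set} where

    ∑-cong : ∀ (L : List X) {f g} → (∀ x → x ∈ L → f x ≡ g x) → ∑ L f ≡ ∑ L g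
    ∑-cong []      eq = refl
    ∑-cong (x ∷ L) eq = cong₂ _+_ (eq x (here refl)) (∑-cong L (λ y m → eq y (there m)))

    ∑-mono : ∀ (L : List X) {f g} → (∀ x → x ∈ L → f x ≤ g x) → ∑ L f ≤ ∑ L g
    ∑-mono []      le = z≤n
    ∑-mono (x ∷ L) le = ℕP.+-mono-≤ (le x (here refl)) (∑-mono L (λ y m → le y (there m)))

    ∑-+ : ∀ (L : List X) f g → ∑ L (λ x → f x + g x) ≡ ∑ L f + ∑ L g
    ∑-+ []      f g = refl
    ∑-+ (x ∷ L) f g =
      trans (cong (f x + g x +_) (∑-+ L f g)) (+-interchange (f x) (g x) (∑ L f) (∑ L g))

    ∑-* : ∀ (L : List X) k f → ∑ L (λ x → k * f x) ≡ k * ∑ L f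
    ∑-* []      k f = sym (ℕP.*-zeroʳ k)
    ∑-* (x ∷ L) k f = trans (cong (k * f x +_) (∑-* L k f)) (sym (ℕP.*-distribˡ-+ k (f x) _))

    ∑-map : ∀ {Y : Set} (L : List Y) (h : Y → X) f → ∑ (map h L) f ≡ ∑ L (f ∘ h)
    ∑-map []      h f = refl
    ∑-map (x ∷ L) h f = cong (f (h x) +_) (∑-map L h f)

    ∑-positive : ∀ (L : List X) f → 0 < ∑ L f → ∃[ x ] x ∈ L × 0 < f x
    ∑-positive (x ∷ L) f pos with f x in fx
    ... | suc _ = x , here refl , subst (0 <_) (sym fx) (s≤s z≤n)
    ... | zero  with ∑-positive L f pos
    ...   | y , y∈L , fy = y , there y∈L , fy

  ∑-swap : ∀ {X Y : Set} (L : List X) (M : List Y) (G : X → Y → ℕ) →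
           ∑ L (λ x → ∑ M (G x)) ≡ ∑ M (λ y → ∑ L (λ x → G x y))
  ∑-swap []      M G = sym (∑-zero M)
    where
    ∑-zero : ∀ {Y : Set} (M : List Y) → ∑ M (λ _ → 0) ≡ 0
    ∑-zero []      = refl
    ∑-zero (_ ∷ M) = ∑-zero M
  ∑-swap (x ∷ L) M G =
    trans (cong (∑ M (G x) +_) (∑-swap L M G)) (sym (∑-+ M (G x) (λ y → ∑ L (λ z → G z y))))

  module SupportBound {X : Set} (_≟_ : DecidableEquality X) where

    remove : X → List X → List X
    remove x [] = []
    remove x (y ∷ ys) with x ≟ y
    ... | yes _ = ys
    ... | no  _ = y ∷ remove x ys

    ∑-remove : ∀ f x ys → x ∈ ys → ∑ ys f ≡ f x + ∑ (remove x ys) f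
    ∑-remove f x (y ∷ ys) x∈ with x ≟ y
    ... | yes refl = refl
    ∑-remove f x (y ∷ ys) (here refl) | no x≢y = ⊥-elim (x≢y refl)
    ∑-remove f x (y ∷ ys) (there x∈)  | no _   =
      trans (cong (f y +_) (∑-remove f x ys x∈)) (+-left-comm (f y) (f x) _)

    ∈-remove : ∀ {x y} ys → y ∈ ys → y ≢ x → y ∈ remove x ys
    ∈-remove {x} (z ∷ ys) y∈ y≢x with x ≟ z
    ∈-remove (z ∷ ys) (here refl) y≢x | yes refl = ⊥-elim (y≢x refl)
    ∈-remove (z ∷ ys) (there y∈)  y≢x | yes refl = y∈
    ∈-remove (z ∷ ys) (here refl) y≢x | no _     = here refl
    ∈-remove (z ∷ ys) (there y∈)  y≢x | no _     = there (∈-remove ys y∈ y≢x)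

    ∑-≤-support : ∀ f L M → Unique L → (∀ x → x ∈ L → 0 < f x → x ∈ M) → ∑ L f ≤ ∑ M f
    ∑-≤-support f []      M _             _   = z≤n
    ∑-≤-support f (x ∷ L) M (x∉L ∷ uniq) sup with f x in fx
    ... | zero  = ∑-≤-support f L M uniq (λ y m → sup y (there m))
    ... | suc k = begin
        suc k + ∑ L f             ≤⟨ ℕP.+-monoʳ-≤ (suc k) rest ⟩
        suc k + ∑ (remove x M) f  ≡⟨ cong (_+ ∑ (remove x M) f) (sym fx) ⟩
        f x + ∑ (remove x M) f    ≡⟨ sym (∑-remove f x M x∈M) ⟩
        ∑ M f                     ∎
      where
      open ℕP.≤-Reasoning
      x∈M : x ∈ M
      x∈M = sup x (here refl) (subst (0 <_) (sym fx) (s≤s z≤n))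
      rest : ∑ L f ≤ ∑ (remove x M) f
      rest = ∑-≤-support f L (remove x M) uniq
        (λ y y∈L pos → ∈-remove M (sup y (there y∈L) pos) (λ y≡x → All.lookup x∉L y∈L (sym y≡x)))

    length-≤-superset : ∀ L M → Unique L → (∀ x → x ∈ L → x ∈ M) → length L ≤ length M
    length-≤-superset L M uniq ⊆ =
      subst₂ _≤_ (∑-one L) (∑-one M) (∑-≤-support (λ _ → 1) L M uniq (λ x m _ → ⊆ x m))
      where
      ∑-one : ∀ K → ∑ K (λ _ → 1) ≡ length K
      ∑-one []      = refl
      ∑-one (_ ∷ K) = cong suc (∑-one K)

    ∑-reindex : ∀ (n m : X → X) → (∀ x → m (n x) ≡ x) → (∀ x → n (m x) ≡ x) →
                ∀ L → Unique L → (G : X → X → ℕ) → (∀ x k → 0 < G x k → k ∈ L) →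
                ∑ L (λ x → G x (n x)) ≤ ∑ L (λ k → G (m k) k)
    ∑-reindex n m mn nm L uniq G sup = begin
      ∑ L (λ x → G x (n x))             ≤⟨ ∑-≤-support _ L (map m L) uniq image ⟩
      ∑ (map m L) (λ x → G x (n x))     ≡⟨ ∑-map L m _ ⟩
      ∑ L (λ k → G (m k) (n (m k)))     ≡⟨ ∑-cong L (λ k _ → cong (G (m k)) (nm k)) ⟩
      ∑ L (λ k → G (m k) k)             ∎
      where
      open ℕP.≤-Reasoning
      image : ∀ x → x ∈ L → 0 < G x (n x) → x ∈ map m L
      image x _ pos = subst (_∈ map m L) (mn x) (∈-map⁺ m (sup x (n x) pos))

  positive-right : ∀ m {n} → 0 < m * n → 0 < n
  positive-right m {zero}  pos = ⊥-elim (ℕP.<-irrefl (sym (ℕP.*-zeroʳ m)) pos)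
  positive-right m {suc n} _   = s≤s z≤n

  nine-plus-surplus : ∀ a o → 3 * o ≤ 7 * a → 9 * o + 3 * (7 * a ∸ 3 * o) ≡ 21 * a
  nine-plus-surplus a o le = begin
    9 * o + 3 * (7 * a ∸ 3 * o)             ≡⟨ cong (9 * o +_) (ℕP.*-distribˡ-∸ 3 (7 * a) (3 * o)) ⟩
    9 * o + (3 * (7 * a) ∸ 3 * (3 * o))     ≡⟨ cong₂ (λ x y → 9 * o + (x ∸ y)) (ℕP.*-assoc 3 7 a) (ℕP.*-assoc 3 3 o) ⟨
    9 * o + (21 * a ∸ 9 * o)                ≡⟨ ℕP.m+[n∸m]≡n (subst₂ _≤_ (sym (ℕP.*-assoc 3 3 o)) (sym (ℕP.*-assoc 3 7 a)) (ℕP.*-monoʳ-≤ 3 le)) ⟩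
    21 * a                                  ∎
    where open ≡-Reasoning

  surplus⇒calls : ∀ a o → 0 < 7 * a ∸ o → 0 < a
  surplus⇒calls zero    o pos = ⊥-elim (ℕP.<-irrefl (sym (ℕP.0∸n≡0 o)) pos)
  surplus⇒calls (suc a) o _   = s≤s z≤n

  indicator-pair : ∀ x y → (x ≡ false → y ≡ false → ⊥) → (if x then 0 else 1) + (if y then 0 else 1) ≤ 1
  indicator-pair true  true  _   = z≤n
  indicator-pair true  false _   = ℕP.≤-refl
  indicator-pair false true  _   = ℕP.≤-refl
  indicator-pair false false bad = ⊥-elim (bad refl refl)

  heavy-pair : ∀ {w x z} → 2 * w < 3 * x → 2 * w < 3 * z → x + z ≤ w → ⊥
  heavy-pair {w} {x} {z} hx hz x+z≤w = ℕP.<-irrefl refl (begin-strict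
    3 * w                       <⟨ ℕP.m<m+n (3 * w) (s≤s z≤n) ⟩
    3 * w + suc w               ≤⟨ ℕP.n≤1+n _ ⟩
    suc (3 * w + suc w)         ≡⟨ four-thirds w ⟨
    suc (2 * w) + suc (2 * w)   ≤⟨ ℕP.+-mono-≤ hx hz ⟩
    3 * x + 3 * z               ≡⟨ ℕP.*-distribˡ-+ 3 x z ⟨
    3 * (x + z)                 ≤⟨ ℕP.*-monoʳ-≤ 3 x+z≤w ⟩
    3 * w                       ∎)
    where
    open ℕP.≤-Reasoning
    four-thirds : ∀ w → suc (2 * w) + suc (2 * w) ≡ suc (3 * w + suc w)
    four-thirds = ℕ-Solver.solve-∀

  -- ℕ→ℚ is a monotone semiring homomorphism.  Proofs go through ℚᵘ, where
  -- + and * are not normalised and toℚᵘ is injective.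
  toℚᵘ-/ : ∀ i d → toℚᵘ (i ℚ./ suc d) ≃ mkℚᵘ i d
  toℚᵘ-/ i d = ℚP.toℚᵘ-fromℚᵘ (mkℚᵘ i d)

  ℕ→ℚ-+ : ∀ m n → ℕ→ℚ (m + n) ≡ ℕ→ℚ m ℚ.+ ℕ→ℚ n
  ℕ→ℚ-+ m n = ℚP.toℚᵘ-injective (begin
    toℚᵘ (ℕ→ℚ (m + n))                        ≈⟨ toℚᵘ-/ (ℤ.+ (m + n)) 0 ⟩
    mkℚᵘ (ℤ.+ (m + n)) 0                       ≈⟨ *≡* (cong (ℤ._* ℤ.1ℤ) (trans (ℤP.pos-+ m n) (unit-denominators (ℤ.+ m) (ℤ.+ n)))) ⟩
    mkℚᵘ (ℤ.+ m) 0 ℚᵘ.+ mkℚᵘ (ℤ.+ n) 0         ≈⟨ ℚᵘP.+-cong (toℚᵘ-/ (ℤ.+ m) 0) (toℚᵘ-/ (ℤ.+ n) 0) ⟨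
    toℚᵘ (ℕ→ℚ m) ℚᵘ.+ toℚᵘ (ℕ→ℚ n)            ≈⟨ ℚP.toℚᵘ-homo-+ (ℕ→ℚ m) (ℕ→ℚ n) ⟨
    toℚᵘ (ℕ→ℚ m ℚ.+ ℕ→ℚ n)                    ∎)
    where
    open ℚᵘP.≃-Reasoning
    unit-denominators : ∀ a b → a ℤ.+ b ≡ a ℤ.* ℤ.1ℤ ℤ.+ b ℤ.* ℤ.1ℤ
    unit-denominators = solve-∀

  ℕ→ℚ-* : ∀ m n → ℕ→ℚ (m * n) ≡ ℕ→ℚ m ℚ.* ℕ→ℚ n
  ℕ→ℚ-* m n = ℚP.toℚᵘ-injective (begin
    toℚᵘ (ℕ→ℚ (m * n))                        ≈⟨ toℚᵘ-/ (ℤ.+ (m * n)) 0 ⟩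
    mkℚᵘ (ℤ.+ (m * n)) 0                       ≈⟨ *≡* (cong (ℤ._* ℤ.1ℤ) (ℤP.pos-* m n)) ⟩
    mkℚᵘ (ℤ.+ m) 0 ℚᵘ.* mkℚᵘ (ℤ.+ n) 0         ≈⟨ ℚᵘP.*-cong (toℚᵘ-/ (ℤ.+ m) 0) (toℚᵘ-/ (ℤ.+ n) 0) ⟨
    toℚᵘ (ℕ→ℚ m) ℚᵘ.* toℚᵘ (ℕ→ℚ n)            ≈⟨ ℚP.toℚᵘ-homo-* (ℕ→ℚ m) (ℕ→ℚ n) ⟨
    toℚᵘ (ℕ→ℚ m ℚ.* ℕ→ℚ n)                    ∎)
    where open ℚᵘP.≃-Reasoning

  /-as-* : ∀ n d → (ℤ.+ n) ℚ./ suc d ≡ ℕ→ℚ n ℚ.* ((ℤ.+ 1) ℚ./ suc d)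
  /-as-* n d = ℚP.toℚᵘ-injective (begin
    toℚᵘ ((ℤ.+ n) ℚ./ suc d)                  ≈⟨ toℚᵘ-/ (ℤ.+ n) d ⟩
    mkℚᵘ (ℤ.+ n) d                             ≈⟨ *≡* cross ⟩
    mkℚᵘ (ℤ.+ n) 0 ℚᵘ.* mkℚᵘ (ℤ.+ 1) d         ≈⟨ ℚᵘP.*-cong (toℚᵘ-/ (ℤ.+ n) 0) (toℚᵘ-/ (ℤ.+ 1) d) ⟨
    toℚᵘ (ℕ→ℚ n) ℚᵘ.* toℚᵘ ((ℤ.+ 1) ℚ./ suc d) ≈⟨ ℚP.toℚᵘ-homo-* (ℕ→ℚ n) _ ⟨
    toℚᵘ (ℕ→ℚ n ℚ.* ((ℤ.+ 1) ℚ./ suc d))      ∎)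
    where
    open ℚᵘP.≃-Reasoning
    cross : ℤ.+ n ℤ.* ℤ.+ suc (d + 0) ≡ (ℤ.+ n ℤ.* ℤ.+ 1) ℤ.* ℤ.+ suc d
    cross rewrite ℕP.+-identityʳ d | ℤP.*-identityʳ (ℤ.+ n) = refl

  /-≤-/ : ∀ m a n b → (ℤ.+ m) ℚ./ suc a ℚ.≤ (ℤ.+ n) ℚ./ suc b ⇔ m * suc b ≤ n * suc a
  /-≤-/ m a n b = mk⇔
    (λ p≤q → ℤP.drop‿+≤+ (cross (ℚᵘP.≤-respˡ-≃ (toℚᵘ-/ (ℤ.+ m) a) (ℚᵘP.≤-respʳ-≃ (toℚᵘ-/ (ℤ.+ n) b) (ℚP.toℚᵘ-mono-≤ p≤q)))))
    (λ le → ℚP.toℚᵘ-cancel-≤ (ℚᵘP.≤-respˡ-≃ (ℚᵘP.≃-sym (toℚᵘ-/ (ℤ.+ m) a))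
              (ℚᵘP.≤-respʳ-≃ (ℚᵘP.≃-sym (toℚᵘ-/ (ℤ.+ n) b)) (*≤* (uncross (ℤ.+≤+ le))))))
    where
    cross : mkℚᵘ (ℤ.+ m) a ℚᵘ.≤ mkℚᵘ (ℤ.+ n) b → ℤ.+ (m * suc b) ℤ.≤ ℤ.+ (n * suc a)
    cross (*≤* le) = subst₂ ℤ._≤_ (sym (ℤP.pos-* m (suc b))) (sym (ℤP.pos-* n (suc a))) le
    uncross : ℤ.+ (m * suc b) ℤ.≤ ℤ.+ (n * suc a) → ℤ.+ m ℤ.* ℤ.+ suc b ℤ.≤ ℤ.+ n ℤ.* ℤ.+ suc a
    uncross = subst₂ ℤ._≤_ (ℤP.pos-* m (suc b)) (ℤP.pos-* n (suc a))

  ℕ→ℚ-mono : ∀ {m n} → m ≤ n → ℕ→ℚ m ℚ.≤ ℕ→ℚ n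
  ℕ→ℚ-mono {m} {n} le = Equivalence.from (/-≤-/ m 0 n 0) (ℕP.*-monoˡ-≤ 1 le)

  sumℚ-scaled : ∀ {X : Set} (L : List X) (g : X → ℚ) (h : X → ℕ) r →
                (∀ x → x ∈ L → g x ≡ ℕ→ℚ (h x) ℚ.* r) → sumℚ (map g L) ≡ ℕ→ℚ (∑ L h) ℚ.* r
  sumℚ-scaled []      g h r _  = sym (ℚP.*-zeroˡ r)
  sumℚ-scaled (x ∷ L) g h r eq = begin
    g x ℚ.+ sumℚ (map g L)                    ≡⟨ cong₂ ℚ._+_ (eq x (here refl)) (sumℚ-scaled L g h r (λ y m → eq y (there m))) ⟩
    ℕ→ℚ (h x) ℚ.* r ℚ.+ ℕ→ℚ (∑ L h) ℚ.* r   ≡⟨ ℚP.*-distribʳ-+ r (ℕ→ℚ (h x)) (ℕ→ℚ (∑ L h)) ⟨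
    (ℕ→ℚ (h x) ℚ.+ ℕ→ℚ (∑ L h)) ℚ.* r       ≡⟨ cong (ℚ._* r) (ℕ→ℚ-+ (h x) (∑ L h)) ⟨
    ℕ→ℚ (h x + ∑ L h) ℚ.* r                 ∎
    where open ≡-Reasoning

  ⅓ ⅐ ⅟₂₁ : ℚ
  ⅓ = (ℤ.+ 1) ℚ./ 3
  ⅐ = (ℤ.+ 1) ℚ./ 7
  ⅟₂₁ = (ℤ.+ 1) ℚ./ 21

  surplus-fraction : ∀ a o → 3 * o ≤ 7 * a → ℕ→ℚ a ℚ.- (ℤ.+ (3 * o)) ℚ./ 7 ≡ ℕ→ℚ (7 * a ∸ 3 * o) ℚ.* ⅐
  surplus-fraction a o le = begin
    ℕ→ℚ a ℚ.- (ℤ.+ (3 * o)) ℚ./ 7           ≡⟨ cong (λ x → ℕ→ℚ a ℚ.- x) (/-as-* (3 * o) 6) ⟩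
    ℕ→ℚ a ℚ.- ℕ→ℚ (3 * o) ℚ.* ⅐             ≡⟨ times-seven (ℕ→ℚ a) (ℕ→ℚ (3 * o)) ⟩
    (ℕ→ℚ 7 ℚ.* ℕ→ℚ a) ℚ.* ⅐ ℚ.- ℕ→ℚ (3 * o) ℚ.* ⅐
        ≡⟨ cong (λ x → x ℚ.* ⅐ ℚ.- ℕ→ℚ (3 * o) ℚ.* ⅐) split ⟩
    (ℕ→ℚ (7 * a ∸ 3 * o) ℚ.+ ℕ→ℚ (3 * o)) ℚ.* ⅐ ℚ.- ℕ→ℚ (3 * o) ℚ.* ⅐
        ≡⟨ cancel (ℕ→ℚ (7 * a ∸ 3 * o)) (ℕ→ℚ (3 * o)) ⟩
    ℕ→ℚ (7 * a ∸ 3 * o) ℚ.* ⅐               ∎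
    where
    open ≡-Reasoning
    open ℚ-Solver
    split : ℕ→ℚ 7 ℚ.* ℕ→ℚ a ≡ ℕ→ℚ (7 * a ∸ 3 * o) ℚ.+ ℕ→ℚ (3 * o)
    split = trans (sym (ℕ→ℚ-* 7 a)) (trans (cong ℕ→ℚ (sym (ℕP.m∸n+n≡m le))) (ℕ→ℚ-+ (7 * a ∸ 3 * o) (3 * o)))
    times-seven : ∀ x z → x ℚ.- z ℚ.* ⅐ ≡ (ℕ→ℚ 7 ℚ.* x) ℚ.* ⅐ ℚ.- z ℚ.* ⅐
    times-seven = solve 2 (λ x z → x :- z :* con ⅐ := (con (ℕ→ℚ 7) :* x) :* con ⅐ :- z :* con ⅐) refl
    cancel : ∀ y z → (y ℚ.+ z) ℚ.* ⅐ ℚ.- z ℚ.* ⅐ ≡ y ℚ.* ⅐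
    cancel = solve 2 (λ y z → (y :+ z) :* con ⅐ :- z :* con ⅐ := y :* con ⅐) refl

  three-sevenths : ∀ o → (ℤ.+ (3 * o)) ℚ./ 7 ≡ ℕ→ℚ (9 * o) ℚ.* ⅟₂₁
  three-sevenths o = begin
    (ℤ.+ (3 * o)) ℚ./ 7                  ≡⟨ /-as-* (3 * o) 6 ⟩
    ℕ→ℚ (3 * o) ℚ.* ⅐                   ≡⟨ sevenths (ℕ→ℚ (3 * o)) ⟩
    (ℕ→ℚ 3 ℚ.* ℕ→ℚ (3 * o)) ℚ.* ⅟₂₁     ≡⟨ cong (ℚ._* ⅟₂₁) (ℕ→ℚ-* 3 (3 * o)) ⟨
    ℕ→ℚ (3 * (3 * o)) ℚ.* ⅟₂₁           ≡⟨ cong (λ x → ℕ→ℚ x ℚ.* ⅟₂₁) (ℕP.*-assoc 3 3 o) ⟨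
    ℕ→ℚ (9 * o) ℚ.* ⅟₂₁                 ∎
    where
    open ≡-Reasoning
    open ℚ-Solver
    sevenths : ∀ x → x ℚ.* ⅐ ≡ (ℕ→ℚ 3 ℚ.* x) ℚ.* ⅟₂₁
    sevenths = solve 1 (λ x → x :* con ⅐ := (con (ℕ→ℚ 3) :* x) :* con ⅟₂₁) refl

  safeᵇ⇔ : ∀ ω o → safeᵇ ω o ≡ true ⇔ 3 * o ≤ 2 * ω
  safeᵇ⇔ ω o = mk⇔
    (λ safe → normalise (Equivalence.to (/-≤-/ o 0 (2 * ω) 2) (ℚP.≤ᵇ⇒≤ (Equivalence.from T-≡ safe))))
    (λ le → Equivalence.to T-≡ (ℚP.≤⇒≤ᵇ (Equivalence.from (/-≤-/ o 0 (2 * ω) 2) (denormalise le))))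
    where
    normalise : o * 3 ≤ 2 * ω * 1 → 3 * o ≤ 2 * ω
    normalise = subst₂ _≤_ (ℕP.*-comm o 3) (ℕP.*-identityʳ (2 * ω))
    denormalise : 3 * o ≤ 2 * ω → o * 3 ≤ 2 * ω * 1
    denormalise = subst₂ _≤_ (ℕP.*-comm 3 o) (sym (ℕP.*-identityʳ (2 * ω)))

  dangerous⇒ : ∀ ω o → safeᵇ ω o ≡ false → 2 * ω < 3 * o
  dangerous⇒ ω o dangerous = ℕP.≰⇒> λ le → case trans (sym (Equivalence.from (safeᵇ⇔ ω o) le)) dangerous of λ ()

  _≟ᶜ_ : DecidableEquality Cell
  (p , q) ≟ᶜ (r , s) =
    map′ (λ (p≡r , q≡s) → cong₂ _,_ p≡r q≡s) (λ eq → cong proj₁ eq , cong proj₂ eq)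
         ((p ℤ.≟ r) ×-dec (q ℤ.≟ s))

  ==-does : ∀ a b → a == b ≡ does (a ≟ᶜ b)
  ==-does (p , q) (r , s) = cong₂ _∧_ (isYes≗does (p ℤ.≟ r)) (isYes≗does (q ℤ.≟ s))

  ==-sound : ∀ a b → a == b ≡ true → a ≡ b
  ==-sound a b eq = invert (subst (Reflects (a ≡ b)) (trans (sym (==-does a b)) eq) (proof (a ≟ᶜ b)))

  ==-refl : ∀ a → a == a ≡ true
  ==-refl a = trans (==-does a a) (dec-true (a ≟ᶜ a) refl)

  any-intro : ∀ {X : Set} (P : X → Bool) {L x} → x ∈ L → P x ≡ true → any P L ≡ true
  any-intro P x∈L Px = Equivalence.to T-≡
    (any⁺ P (Any.map (λ { refl → Equivalence.from T-≡ Px }) x∈L))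

  any-elim : ∀ {X : Set} (P : X → Bool) L → any P L ≡ true → ∃[ x ] x ∈ L × P x ≡ true
  any-elim P L eq with find (any⁻ P L (Equivalence.from T-≡ eq))
  ... | x , x∈L , Px = x , x∈L , Equivalence.to T-≡ Px

  shift-≢ : ∀ i j → j ≢ ℤ.0ℤ → i ℤ.+ j ≢ i
  shift-≢ i j j≢0 eq = j≢0 (begin
    j              ≡⟨ cancel i j ⟩
    i ℤ.+ j ℤ.- i  ≡⟨ cong (ℤ._- i) eq ⟩
    i ℤ.- i        ≡⟨ ℤP.+-inverseʳ i ⟩
    ℤ.0ℤ           ∎)
    where
    open ≡-Reasoning
    cancel : ∀ i j → j ≡ i ℤ.+ j ℤ.- i
    cancel = solve-∀

  -- The six directions of the hexagonal grid in axial coordinates, listed in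
  -- the order in which Defs enumerates the neighbours of a cell.
  data Direction : Set where
    q⁺ q⁻ r⁺ r⁻ q⁺r⁻ q⁻r⁺ : Direction

  directions : List Direction
  directions = q⁺ ∷ q⁻ ∷ r⁺ ∷ r⁻ ∷ q⁺r⁻ ∷ q⁻r⁺ ∷ []

  ∈-directions : ∀ d → d ∈ directions
  ∈-directions q⁺   = here refl
  ∈-directions q⁻   = there (here refl)
  ∈-directions r⁺   = there (there (here refl))
  ∈-directions r⁻   = there (there (there (here refl)))
  ∈-directions q⁺r⁻ = there (there (there (there (here refl))))
  ∈-directions q⁻r⁺ = there (there (there (there (there (here refl)))))

  step : Direction → Cell → Cell
  step q⁺   (q , r) = (q ℤ.+ ℤ.1ℤ , r)
  step q⁻   (q , r) = (q ℤ.- ℤ.1ℤ , r)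
  step r⁺   (q , r) = (q , r ℤ.+ ℤ.1ℤ)
  step r⁻   (q , r) = (q , r ℤ.- ℤ.1ℤ)
  step q⁺r⁻ (q , r) = (q ℤ.+ ℤ.1ℤ , r ℤ.- ℤ.1ℤ)
  step q⁻r⁺ (q , r) = (q ℤ.- ℤ.1ℤ , r ℤ.+ ℤ.1ℤ)

  opposite : Direction → Direction
  opposite q⁺   = q⁻
  opposite q⁻   = q⁺
  opposite r⁺   = r⁻
  opposite r⁻   = r⁺
  opposite q⁺r⁻ = q⁻r⁺
  opposite q⁻r⁺ = q⁺r⁻

  +1-1 : ∀ i → i ℤ.+ ℤ.1ℤ ℤ.- ℤ.1ℤ ≡ i
  +1-1 i = trans (ℤP.+-assoc i ℤ.1ℤ ℤ.-1ℤ) (ℤP.+-identityʳ i)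

  -1+1 : ∀ i → i ℤ.- ℤ.1ℤ ℤ.+ ℤ.1ℤ ≡ i
  -1+1 i = trans (ℤP.+-assoc i ℤ.-1ℤ ℤ.1ℤ) (ℤP.+-identityʳ i)

  step-opposite : ∀ d c → step (opposite d) (step d c) ≡ c
  step-opposite q⁺   (q , r) = cong (_, r) (+1-1 q)
  step-opposite q⁻   (q , r) = cong (_, r) (-1+1 q)
  step-opposite r⁺   (q , r) = cong (q ,_) (+1-1 r)
  step-opposite r⁻   (q , r) = cong (q ,_) (-1+1 r)
  step-opposite q⁺r⁻ (q , r) = cong₂ _,_ (+1-1 q) (-1+1 r)
  step-opposite q⁻r⁺ (q , r) = cong₂ _,_ (-1+1 q) (+1-1 r)

  opposite-involutive : ∀ d → opposite (opposite d) ≡ d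
  opposite-involutive q⁺   = refl
  opposite-involutive q⁻   = refl
  opposite-involutive r⁺   = refl
  opposite-involutive r⁻   = refl
  opposite-involutive q⁺r⁻ = refl
  opposite-involutive q⁻r⁺ = refl

  step-opposite′ : ∀ d c → step d (step (opposite d) c) ≡ c
  step-opposite′ d c = subst (λ e → step e (step (opposite d) c) ≡ c) (opposite-involutive d) (step-opposite (opposite d) c)

  ∑-opposite : ∀ f → ∑ directions (f ∘ opposite) ≡ ∑ directions f
  ∑-opposite f = swap-pairs (f q⁺) (f q⁻) (f r⁺) (f r⁻) (f q⁺r⁻) (f q⁻r⁺)
    where
    swap-pairs : ∀ a b c d e g → b + (a + (d + (c + (g + (e + 0))))) ≡ a + (b + (c + (d + (e + (g + 0)))))
    swap-pairs = ℕ-Solver.solve-∀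

  step-moves : ∀ d c → step d c ≢ c
  step-moves q⁺   (q , r) eq = shift-≢ q ℤ.1ℤ (λ ()) (cong proj₁ eq)
  step-moves q⁻   (q , r) eq = shift-≢ q ℤ.-1ℤ (λ ()) (cong proj₁ eq)
  step-moves r⁺   (q , r) eq = shift-≢ r ℤ.1ℤ (λ ()) (cong proj₂ eq)
  step-moves r⁻   (q , r) eq = shift-≢ r ℤ.-1ℤ (λ ()) (cong proj₂ eq)
  step-moves q⁺r⁻ (q , r) eq = shift-≢ q ℤ.1ℤ (λ ()) (cong proj₁ eq)
  step-moves q⁻r⁺ (q , r) eq = shift-≢ q ℤ.-1ℤ (λ ()) (cong proj₁ eq)

  neighbour⇒adjacent : ∀ c {x} → x ∈ neighbours c → Adjacent c x
  neighbour⇒adjacent c {x} x∈ = any-intro (_== x) x∈ (==-refl x)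

  adjacent-step : ∀ d c → Adjacent c (step d c)
  adjacent-step d c = neighbour⇒adjacent c (∈-map⁺ (λ e → step e c) (∈-directions d))

  adjacent⇒step : ∀ {a b} → Adjacent a b → ∃[ d ] step d a ≡ b
  adjacent⇒step {a} {b} adj with any-elim (_== b) (neighbours a) adj
  ... | x , x∈ , x==b with ∈-map⁻ (λ e → step e a) {xs = directions} x∈
  ...   | d , _ , refl = d , ==-sound x b x==b

  adjacent⇒≢ : ∀ {a b} → Adjacent a b → a ≢ b
  adjacent⇒≢ {a} adj refl with adjacent⇒step {a} adj
  ... | d , eq = step-moves d a eq

  adjacent-pair₁ : ∀ k → Adjacent (step q⁺ k) (step q⁺r⁻ k)
  adjacent-pair₁ k = adjacent-step r⁻ (step q⁺ k)

  adjacent-pair₂ : ∀ k → Adjacent (step r⁺ k) (step q⁻r⁺ k)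
  adjacent-pair₂ k = adjacent-step q⁻ (step r⁺ k)

  adjacent-pair₃ : ∀ k → Adjacent (step q⁻ k) (step r⁻ k)
  adjacent-pair₃ k =
    subst (Adjacent (step q⁻ k)) (cong (_, _) (-1+1 (proj₁ k))) (adjacent-step q⁺r⁻ (step q⁻ k))

  separated : ∀ {a b} → Adjacent a b → adjᵇ a b ≡ false → ⊥
  separated adj notAdjacent = case trans (sym adj) notAdjacent of λ ()

  adjacent-sym : ∀ {a b} → Adjacent a b → Adjacent b a
  adjacent-sym {a} adj with adjacent⇒step {a} adj
  ... | d , refl = subst (Adjacent (step d a)) (step-opposite d a) (adjacent-step (opposite d) (step d a))

  ∈-1…n : ∀ {n f} → 1 ≤ f × f ≤ n → f ∈ map suc (upTo n)
  ∈-1…n {f = suc f} (_ , f<n) = ∈-map⁺ suc (∈-upTo⁺ f<n)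

  open SupportBound ℕ._≟_ using (length-≤-superset)

  -- Two adjacent cells share the spectrum: a feasible assignment accepts at most ω
  -- calls in a and b together, because all their frequencies are distinct and lie in 1..ω.
  module AdjacentLoad (ω : ℕ) (σ : List Cell) (asg : Assignment σ) (feasible : Feasible ω σ asg)
                      {a b : Cell} (adj : Adjacent a b) where

    Request : Set
    Request = Fin (length σ)

    InPair : Cell → Set
    InPair c = c ≡ a ⊎ c ≡ b

    pairFrequencies : List Request → List ℕ
    pairFrequencies []      = []
    pairFrequencies (i ∷ I) with asg i | lookup σ i == a | lookup σ i == b
    ... | nothing | _     | _     = pairFrequencies I
    ... | just f  | true  | _     = f ∷ pairFrequencies I
    ... | just f  | false | true  = f ∷ pairFrequencies I
    ... | just f  | false | false = pairFrequencies I

    accepted-in : Cell → Request → ℕ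
    accepted-in c i = if is-just (asg i) ∧ (lookup σ i == c) then 1 else 0

    -- every accepted request in a or b contributes a frequency (a ≠ b as they are adjacent)
    pairFrequencies-length : ∀ I → ∑ I (accepted-in a) + ∑ I (accepted-in b) ≤ length (pairFrequencies I)
    pairFrequencies-length []      = z≤n
    pairFrequencies-length (i ∷ I) with asg i | lookup σ i == a in ia | lookup σ i == b in ib
    ... | nothing | _     | _     = pairFrequencies-length I
    ... | just f  | true  | true  = ⊥-elim (adjacent⇒≢ {a} {b} adj (trans (sym (==-sound (lookup σ i) a ia)) (==-sound (lookup σ i) b ib)))
    ... | just f  | true  | false = s≤s (pairFrequencies-length I)
    ... | just f  | false | true  =
      subst (_≤ length (f ∷ pairFrequencies I)) (sym (ℕP.+-suc (∑ I (accepted-in a)) _)) (s≤s (pairFrequencies-length I))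
    ... | just f  | false | false = pairFrequencies-length I

    Source : List Request → ℕ → Set
    Source I f = ∃[ j ] j ∈ I × asg j ≡ just f × InPair (lookup σ j)

    source-there : ∀ {i I f} → Source I f → Source (i ∷ I) f
    source-there (j , j∈ , aj , pj) = j , there j∈ , aj , pj

    pairFrequencies-source : ∀ I {f} → f ∈ pairFrequencies I → Source I f
    pairFrequencies-source (i ∷ I) f∈ with asg i in ai | lookup σ i == a in ia | lookup σ i == b in ib
    pairFrequencies-source (i ∷ I) (here refl) | just f | true  | _    = i , here refl , ai , inj₁ (==-sound (lookup σ i) a ia)
    pairFrequencies-source (i ∷ I) (here refl) | just f | false | true = i , here refl , ai , inj₂ (==-sound (lookup σ i) b ib)
    pairFrequencies-source (i ∷ I) (there f∈)  | just g | true  | _    = source-there (pairFrequencies-source I f∈)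
    pairFrequencies-source (i ∷ I) (there f∈)  | just g | false | true = source-there (pairFrequencies-source I f∈)
    pairFrequencies-source (i ∷ I) f∈ | just g  | false | false = source-there (pairFrequencies-source I f∈)
    pairFrequencies-source (i ∷ I) f∈ | nothing | _     | _     = source-there (pairFrequencies-source I f∈)

    no-shared-frequency : ∀ {i j f} → i ≢ j → asg i ≡ just f → asg j ≡ just f →
                          InPair (lookup σ i) → InPair (lookup σ j) → ⊥
    no-shared-frequency {i} {j} {f} i≢j ai aj pi pj with proj₂ feasible i j f i≢j ai aj
    ... | different , notAdjacent with pi | pj
    ...   | inj₁ p | inj₁ q = different (trans p (sym q))
    ...   | inj₂ p | inj₂ q = different (trans p (sym q))
    ...   | inj₁ p | inj₂ q = separated {a} {b} adj (subst₂ (λ x y → adjᵇ x y ≡ false) p q notAdjacent)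
    ...   | inj₂ p | inj₁ q = separated {b} {a} (adjacent-sym {a} {b} adj) (subst₂ (λ x y → adjᵇ x y ≡ false) p q notAdjacent)

    fresh : ∀ {i I f g} → All (i ≢_) I → asg i ≡ just f → InPair (lookup σ i) →
            g ∈ pairFrequencies I → f ≢ g
    fresh {I = I} i∉I ai pi g∈ refl with pairFrequencies-source I g∈
    ... | j , j∈I , aj , pj = no-shared-frequency (All.lookup i∉I j∈I) ai aj pi pj

    pairFrequencies-unique : ∀ I → Unique I → Unique (pairFrequencies I)
    pairFrequencies-unique []      []           = []
    pairFrequencies-unique (i ∷ I) (i∉I ∷ uniq) with asg i in ai | lookup σ i == a in ia | lookup σ i == b in ib
    ... | nothing | _     | _     = pairFrequencies-unique I uniq
    ... | just f  | true  | _     = All.tabulate (fresh i∉I ai (inj₁ (==-sound (lookup σ i) a ia))) ∷ pairFrequencies-unique I uniq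
    ... | just f  | false | true  = All.tabulate (fresh i∉I ai (inj₂ (==-sound (lookup σ i) b ib))) ∷ pairFrequencies-unique I uniq
    ... | just f  | false | false = pairFrequencies-unique I uniq

    adjacent-load : O σ asg a + O σ asg b ≤ ω
    adjacent-load = begin
      O σ asg a + O σ asg b                ≤⟨ pairFrequencies-length requests ⟩
      length (pairFrequencies requests)    ≤⟨ length-≤-superset _ _ (pairFrequencies-unique requests (allFin⁺ _)) in-spectrum ⟩
      length (map suc (upTo ω))            ≡⟨ trans (length-map suc (upTo ω)) (length-upTo ω) ⟩
      ω                                    ∎
      where
      open ℕP.≤-Reasoning
      requests : List Request
      requests = allFin (length σ)
      in-spectrum : ∀ f → f ∈ pairFrequencies requests → f ∈ map suc (upTo ω)
      in-spectrum f f∈ with pairFrequencies-source requests f∈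
      ... | j , _ , aj , _ = ∈-1…n (proj₁ feasible j f aj)

  requests : List Cell → Cell → ℕ
  requests σ k = ∑ σ (λ x → if x == k then 1 else 0)

  O≤requests : ∀ σ (asg : Assignment σ) k → O σ asg k ≤ requests σ k
  O≤requests σ asg k = begin
    O σ asg k                                      ≤⟨ ∑-mono (allFin (length σ)) accepted≤requested ⟩
    ∑ (allFin (length σ)) (λ i → at (lookup σ i))  ≡⟨ ∑-map (allFin (length σ)) (lookup σ) at ⟨
    ∑ (map (lookup σ) (allFin (length σ))) at      ≡⟨ cong (λ L → ∑ L at) lookups ⟩
    requests σ k                                   ∎
    where
    open ℕP.≤-Reasoning
    at : Cell → ℕ
    at x = if x == k then 1 else 0
    accepted≤requested : ∀ i → i ∈ allFin (length σ) → (if is-just (asg i) ∧ (lookup σ i == k) then 1 else 0) ≤ at (lookup σ i)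
    accepted≤requested i _ with is-just (asg i)
    ... | true  = ℕP.≤-refl
    ... | false = z≤n
    lookups : map (lookup σ) (allFin (length σ)) ≡ σ
    lookups = trans (map-tabulate (λ i → i) (lookup σ)) (tabulate-lookup σ)

  countCell-snoc : ∀ s x f k → countCell (s ++ (x , f) ∷ []) k ≡ countCell s k + (if x == k then 1 else 0)
  countCell-snoc []      x f k with x == k
  ... | true  = refl
  ... | false = refl
  countCell-snoc (p ∷ s) x f k with proj₁ p == k
  ... | true  = cong suc (countCell-snoc s x f k)
  ... | false = countCell-snoc s x f k

  frequenciesAt : State → Cell → List ℕ
  frequenciesAt []      c = []
  frequenciesAt (p ∷ s) c = if proj₁ p == c then proj₂ p ∷ frequenciesAt s c else frequenciesAt s c

  frequenciesAt-length : ∀ s c → length (frequenciesAt s c) ≡ countCell s c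
  frequenciesAt-length []      c = refl
  frequenciesAt-length (p ∷ s) c with proj₁ p == c
  ... | true  = cong suc (frequenciesAt-length s c)
  ... | false = frequenciesAt-length s c

  ∈-frequenciesAt : ∀ {s c p} → p ∈ s → proj₁ p == c ≡ true → proj₂ p ∈ frequenciesAt s c
  ∈-frequenciesAt {q ∷ s} {c} (here refl) at-c rewrite at-c = here refl
  ∈-frequenciesAt {q ∷ s} {c} (there p∈) at-c with proj₁ q == c
  ... | true  = there (∈-frequenciesAt p∈ at-c)
  ... | false = ∈-frequenciesAt p∈ at-c

  used⇒∈-frequenciesAt : ∀ s c f → usedIn s c f ≡ true → f ∈ frequenciesAt s c
  used⇒∈-frequenciesAt s c f used with any-elim (λ p → (proj₁ p == c) ∧ ⌊ proj₂ p ℕ.≟ f ⌋) s used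
  ... | p , p∈s , match with Equivalence.to T-∧ (Equivalence.from T-≡ match)
  ...   | at-c , is-f = subst (_∈ frequenciesAt s c) (toWitness is-f) (∈-frequenciesAt p∈s (Equivalence.to T-≡ at-c))

  firstSat-nothing : ∀ P xs → firstSat P xs ≡ nothing → All (λ x → P x ≡ false) xs
  firstSat-nothing P []       _       = []
  firstSat-nothing P (x ∷ xs) none with P x in Px
  ... | false = Px ∷ firstSat-nothing P xs none

  module CACO (ω : ℕ) (col : Cell → Fin 3) where

    band : ℕ
    band = 2 * (ω ℕ./ 7)

    Fcol-length : ∀ c → length (Fcol ω c) ≡ band
    Fcol-length c = trans (length-map _ (upTo band)) (length-upTo band)

    Fcol-unique : ∀ c → Unique (Fcol ω c)
    Fcol-unique c = map⁺ (λ eq → ℕP.suc-injective (ℕP.+-cancelˡ-≡ (2 * toℕ c * (ω ℕ./ 7)) _ _ eq)) (upTo⁺ band)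

    rejected⇒band-full : ∀ s c → cacoStep ω col s c ≡ nothing → band ≤ countCell s c
    rejected⇒band-full s c rejected with firstSat (λ f → not (usedIn s c f)) (Fcol ω (col c)) in none
    ... | nothing = subst₂ _≤_ (Fcol-length (col c)) (frequenciesAt-length s c)
      (length-≤-superset _ _ (Fcol-unique (col c)) λ f f∈ →
        used⇒∈-frequenciesAt s c f (trans (sym (not-involutive _)) (cong not (All.lookup (firstSat-nothing _ _ none) f∈))))

    run : State → List Cell → State
    run = cacoRun ω col

    -- Each request adds at most one call, in its own cell.
    run-upper : ∀ s σ k → countCell (run s σ) k ≤ countCell s k + requests σ k
    run-upper s []      k = ℕP.≤-reflexive (sym (ℕP.+-identityʳ _))
    run-upper s (x ∷ σ) k with cacoStep ω col s x
    ... | just f  = begin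
      countCell (run (s ++ (x , f) ∷ []) σ) k              ≤⟨ run-upper (s ++ (x , f) ∷ []) σ k ⟩
      countCell (s ++ (x , f) ∷ []) k + requests σ k        ≡⟨ cong (_+ requests σ k) (countCell-snoc s x f k) ⟩
      countCell s k + (if x == k then 1 else 0) + requests σ k ≡⟨ ℕP.+-assoc (countCell s k) _ _ ⟩
      countCell s k + requests (x ∷ σ) k                    ∎
      where open ℕP.≤-Reasoning
    ... | nothing = ℕP.≤-trans (run-upper s σ k)
                      (ℕP.+-monoʳ-≤ (countCell s k) (ℕP.m≤n+m (requests σ k) (if x == k then 1 else 0)))

    run-lower : ∀ s σ k → countCell s k + requests σ k ≤ countCell (run s σ) k ⊎ band ≤ countCell (run s σ) k
    run-lower s []      k = inj₁ (ℕP.≤-reflexive (ℕP.+-identityʳ _))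
    run-lower s (x ∷ σ) k with cacoStep ω col s x in step≡
    ... | just f with run-lower (s ++ (x , f) ∷ []) σ k
    ...   | inj₂ full   = inj₂ full
    ...   | inj₁ served = inj₁ (subst (_≤ countCell (run (s ++ (x , f) ∷ []) σ) k)
                                      (trans (cong (_+ requests σ k) (countCell-snoc s x f k)) (ℕP.+-assoc (countCell s k) _ _))
                                      served)
    run-lower s (x ∷ σ) k | nothing with x == k in x==k | run-lower s σ k
    ... | false | rest        = rest
    ... | true  | inj₂ full   = inj₂ full
    ... | true  | inj₁ served = inj₂ (ℕP.≤-trans (subst (λ c → band ≤ countCell s c) (==-sound x k x==k) (rejected⇒band-full s x step≡))
                                                 (ℕP.≤-trans (ℕP.m≤m+n (countCell s k) _) served))

    A-lower : ∀ σ k → requests σ k ≤ A ω col σ k ⊎ band ≤ A ω col σ k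
    A-lower σ k = run-lower [] σ k

    A-support : ∀ σ k → 0 < A ω col σ k → k ∈ σ
    A-support σ k pos with ∑-positive σ _ (ℕP.<-≤-trans pos (run-upper [] σ k))
    ... | x , x∈σ , at-k with x == k in x==k
    ...   | true = subst (_∈ σ) (==-sound x k x==k) x∈σ
    -- (for x == k false the term at-k would have type 0 < 0)

  module Charging (ω t : ℕ) (ω≡ : ω ≡ t * 7) (col : Cell → Fin 3)
                  (σ : List Cell) (opt : Assignment σ) (feasible : Feasible ω σ opt)
                  (cells : List Cell) (cells-unique : Unique cells) (cover : ∀ c → c ∈ σ → c ∈ cells) where

    open CACO ω col using (band; A-lower; A-support)
    open SupportBound _≟ᶜ_ using (∑-reindex)

    Aₖ Oₖ : Cell → ℕ
    Aₖ = A ω col σ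
    Oₖ = O σ opt

    safe : Cell → Bool
    safe k = safeᵇ ω (Oₖ k)

    dangerous : Cell → ℕ
    dangerous k = if safe k then 0 else 1

    -- 7·(A_k − 3·O_k/7), the surplus of CACO over 3/7 of the optimum
    surplus : Cell → ℕ
    surplus k = 7 * Aₖ k ∸ 3 * Oₖ k

    -- 7 ∣ ω makes the band exactly 2ω/7
    band-bound : 2 * ω ≡ 7 * band
    band-bound = begin
      2 * ω            ≡⟨ cong (2 *_) ω≡ ⟩
      2 * (t * 7)      ≡⟨ rearrange t ⟩
      7 * (2 * t)                ≡⟨ cong (λ u → 7 * (2 * u)) (m*n/n≡m t 7) ⟨
      7 * (2 * (t * 7 ℕ./ 7))    ≡⟨ cong (λ u → 7 * (2 * (u ℕ./ 7))) ω≡ ⟨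
      7 * band                   ∎
      where
      open ≡-Reasoning
      rearrange : ∀ t → 2 * (t * 7) ≡ 7 * (2 * t)
      rearrange = ℕ-Solver.solve-∀

    -- On a safe cell CACO accepts at least 3/7 of the optimum: either it served
    -- every request, or it filled its band of 2ω/7 ≥ 3·O/7 frequencies.
    safe⇒surplus : ∀ k → safe k ≡ true → 3 * Oₖ k ≤ 7 * Aₖ k
    safe⇒surplus k is-safe = [ all-served , band-full ]′ (A-lower σ k)
      where
      open ℕP.≤-Reasoning
      all-served : requests σ k ≤ Aₖ k → 3 * Oₖ k ≤ 7 * Aₖ k
      all-served served = begin
        3 * Oₖ k            ≤⟨ ℕP.*-monoˡ-≤ (Oₖ k) (ℕP.≤ᵇ⇒≤ 3 7 _) ⟩
        7 * Oₖ k            ≤⟨ ℕP.*-monoʳ-≤ 7 (O≤requests σ opt k) ⟩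
        7 * requests σ k    ≤⟨ ℕP.*-monoʳ-≤ 7 served ⟩
        7 * Aₖ k            ∎
      band-full : band ≤ Aₖ k → 3 * Oₖ k ≤ 7 * Aₖ k
      band-full full = begin
        3 * Oₖ k   ≤⟨ Equivalence.to (safeᵇ⇔ ω (Oₖ k)) is-safe ⟩
        2 * ω      ≡⟨ band-bound ⟩
        7 * band   ≤⟨ ℕP.*-monoʳ-≤ 7 full ⟩
        7 * Aₖ k   ∎

    dangerous-apart : ∀ u v → Adjacent u v → safe u ≡ false → safe v ≡ false → ⊥
    dangerous-apart u v adj du dv =
      heavy-pair {ω} {Oₖ u} {Oₖ v} (dangerous⇒ ω (Oₖ u) du) (dangerous⇒ ω (Oₖ v) dv)
                 (AdjacentLoad.adjacent-load ω σ opt feasible {u} {v} adj)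

    safe-neighbour : ∀ c k → safe c ≡ false → Adjacent c k → safe k ≡ true
    safe-neighbour c k dc adj = ¬-not (dangerous-apart c k adj dc)

    pair-bound : ∀ u v → Adjacent u v → dangerous u + dangerous v ≤ 1
    pair-bound u v adj = indicator-pair (safe u) (safe v) (dangerous-apart u v adj)

    -- Around any cell at most three of the six neighbours are dangerous:
    -- the neighbours form three adjacent pairs, each with at most one dangerous cell.
    dangerous-neighbours-≤3 : ∀ k → ∑ (neighbours k) dangerous ≤ 3
    dangerous-neighbours-≤3 k = begin
      ∑ (neighbours k) dangerous
        ≡⟨ regroup (δ q⁺) (δ q⁻) (δ r⁺) (δ r⁻) (δ q⁺r⁻) (δ q⁻r⁺) ⟩
      (δ q⁺ + δ q⁺r⁻) + (δ r⁺ + δ q⁻r⁺) + (δ q⁻ + δ r⁻)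
        ≤⟨ ℕP.+-mono-≤ (ℕP.+-mono-≤ (pair-bound (step q⁺ k) (step q⁺r⁻ k) (adjacent-pair₁ k))
                                    (pair-bound (step r⁺ k) (step q⁻r⁺ k) (adjacent-pair₂ k)))
                       (pair-bound (step q⁻ k) (step r⁻ k) (adjacent-pair₃ k)) ⟩
      3
        ∎
      where
      open ℕP.≤-Reasoning
      δ : Direction → ℕ
      δ d = dangerous (step d k)
      regroup : ∀ a b c d e f → a + (b + (c + (d + (e + (f + 0))))) ≡ (a + e) + (c + f) + (b + d)
      regroup = ℕ-Solver.solve-∀

    dangerous-neighbours-of-dangerous : ∀ k → safe k ≡ false → ∑ (neighbours k) dangerous ≤ 0
    dangerous-neighbours-of-dangerous k dk = ∑-mono (neighbours k) neighbour-safe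
      where
      neighbour-safe : ∀ j → j ∈ neighbours k → dangerous j ≤ 0
      neighbour-safe j j∈ =
        subst (λ b → (if b then 0 else 1) ≤ 0) (sym (safe-neighbour k j dk (neighbour⇒adjacent k j∈))) z≤n

    -- Only requested cells have a surplus, so the support of the charges lies in cells.
    -- (This is where the hypothesis that cells covers σ is used.)
    surplus-support : ∀ c k → 0 < dangerous c * surplus k → k ∈ cells
    surplus-support c k pos =
      cover k (A-support σ k (surplus⇒calls (Aₖ k) (3 * Oₖ k) (positive-right (dangerous c) pos)))

    -- the surplus of safe cells (the only surplus that is ever charged)
    safeSurplus : Cell → ℕ
    safeSurplus k = if safe k then surplus k else 0

    charge-per-cell : ∀ k → surplus k * ∑ (neighbours k) dangerous ≤ 3 * safeSurplus k
    charge-per-cell k = by-safety (safe k) refl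
      where
      by-safety : ∀ b → safe k ≡ b → surplus k * ∑ (neighbours k) dangerous ≤ 3 * (if b then surplus k else 0)
      by-safety true  _  = ℕP.≤-trans (ℕP.*-monoʳ-≤ (surplus k) (dangerous-neighbours-≤3 k))
                                      (ℕP.≤-reflexive (ℕP.*-comm (surplus k) 3))
      by-safety false dk = ℕP.≤-reflexive (trans (cong (surplus k *_) (ℕP.n≤0⇒n≡0 (dangerous-neighbours-of-dangerous k dk)))
                                                 (ℕP.*-zeroʳ (surplus k)))

    -- Charging argument: every dangerous cell collects the surplus of each of its (safe)
    -- neighbours.  Regrouping the collected amounts by the giving cell — direction by
    -- direction, via ∑-reindex — shows that each safe cell gives at most three times.
    charging : ∑ cells (λ c → dangerous c * ∑ (neighbours c) surplus) ≤ 3 * ∑ cells safeSurplus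
    charging = begin
      ∑ cells (λ c → dangerous c * ∑ (neighbours c) surplus)
        ≡⟨ ∑-cong cells (λ c _ → sym (∑-* directions (dangerous c) (λ d → surplus (step d c)))) ⟩
      ∑ cells (λ c → ∑ directions (λ d → G c (step d c)))
        ≡⟨ ∑-swap cells directions (λ c d → G c (step d c)) ⟩
      ∑ directions (λ d → ∑ cells (λ c → G c (step d c)))
        ≤⟨ ∑-mono directions (λ d _ → ∑-reindex (step d) (step (opposite d)) (step-opposite d) (step-opposite′ d)
                                                cells cells-unique G surplus-support) ⟩
      ∑ directions (λ d → ∑ cells (λ k → G (step (opposite d) k) k))
        ≡⟨ ∑-swap directions cells (λ d k → G (step (opposite d) k) k) ⟩
      ∑ cells (λ k → ∑ directions (λ d → G (step (opposite d) k) k))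
        ≡⟨ ∑-cong cells (λ k _ → factor k) ⟩
      ∑ cells (λ k → surplus k * ∑ (neighbours k) dangerous)
        ≤⟨ ∑-mono cells (λ k _ → charge-per-cell k) ⟩
      ∑ cells (λ k → 3 * safeSurplus k)
        ≡⟨ ∑-* cells 3 safeSurplus ⟩
      3 * ∑ cells safeSurplus
        ∎
      where
      open ℕP.≤-Reasoning
      G : Cell → Cell → ℕ
      G c k = dangerous c * surplus k
      factor : ∀ k → ∑ directions (λ d → G (step (opposite d) k) k) ≡ surplus k * ∑ (neighbours k) dangerous
      factor k = begin-equality
        ∑ directions (λ d → G (step (opposite d) k) k)                  ≡⟨ ∑-cong directions (λ d _ → ℕP.*-comm (dangerous (step (opposite d) k)) (surplus k)) ⟩
        ∑ directions (λ d → surplus k * dangerous (step (opposite d) k)) ≡⟨ ∑-* directions (surplus k) (λ d → dangerous (step (opposite d) k)) ⟩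
        surplus k * ∑ directions (λ d → dangerous (step (opposite d) k)) ≡⟨ cong (surplus k *_) (∑-opposite (λ d → dangerous (step d k))) ⟩
        surplus k * ∑ (neighbours k) dangerous                          ∎

    -- 21·B_c, a natural number
    scaledB : Cell → ℕ
    scaledB c = if safe c then 9 * Oₖ c else 21 * Aₖ c + ∑ (neighbours c) surplus

    balance : ∀ c → scaledB c + 3 * safeSurplus c ≡ 21 * Aₖ c + dangerous c * ∑ (neighbours c) surplus
    balance c = by-safety (safe c) refl
      where
      Y : ℕ
      Y = ∑ (neighbours c) surplus
      by-safety : ∀ b → safe c ≡ b →
                  (if b then 9 * Oₖ c else 21 * Aₖ c + Y) + 3 * (if b then surplus c else 0)
                  ≡ 21 * Aₖ c + (if b then 0 else 1) * Y
      by-safety true  sc = trans (nine-plus-surplus (Aₖ c) (Oₖ c) (safe⇒surplus c sc)) (sym (ℕP.+-identityʳ (21 * Aₖ c)))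
      by-safety false _  = trans (ℕP.+-identityʳ (21 * Aₖ c + Y)) (cong (21 * Aₖ c +_) (sym (ℕP.*-identityˡ Y)))

    scaled-inequality : ∑ cells scaledB ≤ 21 * ∑ cells Aₖ
    scaled-inequality = ℕP.+-cancelʳ-≤ (3 * ∑ cells safeSurplus) _ _ (begin
      ∑ cells scaledB + 3 * ∑ cells safeSurplus
        ≡⟨ cong (∑ cells scaledB +_) (∑-* cells 3 safeSurplus) ⟨
      ∑ cells scaledB + ∑ cells (λ c → 3 * safeSurplus c)
        ≡⟨ ∑-+ cells scaledB _ ⟨
      ∑ cells (λ c → scaledB c + 3 * safeSurplus c)
        ≡⟨ ∑-cong cells (λ c _ → balance c) ⟩
      ∑ cells (λ c → 21 * Aₖ c + dangerous c * ∑ (neighbours c) surplus)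
        ≡⟨ ∑-+ cells _ _ ⟩
      ∑ cells (λ c → 21 * Aₖ c) + ∑ cells (λ c → dangerous c * ∑ (neighbours c) surplus)
        ≤⟨ ℕP.+-mono-≤ (ℕP.≤-reflexive (∑-* cells 21 Aₖ)) charging ⟩
      21 * ∑ cells Aₖ + 3 * ∑ cells safeSurplus
        ∎)
      where open ℕP.≤-Reasoning

    dangerous-B : ∀ c → safe c ≡ false →
                  ℕ→ℚ (Aₖ c) ℚ.+ ⅓ ℚ.* sumℚ (map (λ k → ℕ→ℚ (Aₖ k) ℚ.- (ℤ.+ (3 * Oₖ k)) ℚ./ 7) (neighbours c))
                  ≡ ℕ→ℚ (21 * Aₖ c + ∑ (neighbours c) surplus) ℚ.* ⅟₂₁
    dangerous-B c dc = begin
      ℕ→ℚ (Aₖ c) ℚ.+ ⅓ ℚ.* sumℚ (map (λ k → ℕ→ℚ (Aₖ k) ℚ.- (ℤ.+ (3 * Oₖ k)) ℚ./ 7) (neighbours c))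
        ≡⟨ cong (λ x → ℕ→ℚ (Aₖ c) ℚ.+ ⅓ ℚ.* x)
                (sumℚ-scaled (neighbours c) (λ k → ℕ→ℚ (Aₖ k) ℚ.- (ℤ.+ (3 * Oₖ k)) ℚ./ 7) surplus ⅐ neighbour-term) ⟩
      ℕ→ℚ (Aₖ c) ℚ.+ ⅓ ℚ.* (ℕ→ℚ Y ℚ.* ⅐)
        ≡⟨ twenty-firsts (ℕ→ℚ (Aₖ c)) (ℕ→ℚ Y) ⟩
      (ℕ→ℚ 21 ℚ.* ℕ→ℚ (Aₖ c) ℚ.+ ℕ→ℚ Y) ℚ.* ⅟₂₁
        ≡⟨ cong (λ x → (x ℚ.+ ℕ→ℚ Y) ℚ.* ⅟₂₁) (ℕ→ℚ-* 21 (Aₖ c)) ⟨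
      (ℕ→ℚ (21 * Aₖ c) ℚ.+ ℕ→ℚ Y) ℚ.* ⅟₂₁
        ≡⟨ cong (ℚ._* ⅟₂₁) (ℕ→ℚ-+ (21 * Aₖ c) Y) ⟨
      ℕ→ℚ (21 * Aₖ c + Y) ℚ.* ⅟₂₁
        ∎
      where
      open ≡-Reasoning
      open ℚ-Solver
      Y : ℕ
      Y = ∑ (neighbours c) surplus
      -- the neighbours of a dangerous cell are safe, so their terms are surpluses
      neighbour-term : ∀ k → k ∈ neighbours c → ℕ→ℚ (Aₖ k) ℚ.- (ℤ.+ (3 * Oₖ k)) ℚ./ 7 ≡ ℕ→ℚ (surplus k) ℚ.* ⅐
      neighbour-term k k∈ =
        surplus-fraction (Aₖ k) (Oₖ k) (safe⇒surplus k (safe-neighbour c k dc (neighbour⇒adjacent c k∈)))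
      twenty-firsts : ∀ a y → a ℚ.+ ⅓ ℚ.* (y ℚ.* ⅐) ≡ (ℕ→ℚ 21 ℚ.* a ℚ.+ y) ℚ.* ⅟₂₁
      twenty-firsts = solve 2 (λ a y → a :+ con ⅓ :* (y :* con ⅐) := (con (ℕ→ℚ 21) :* a :+ y) :* con ⅟₂₁) refl

    B-scaled : ∀ c → B ω col σ opt c ≡ ℕ→ℚ (scaledB c) ℚ.* ⅟₂₁
    B-scaled c = by-safety (safe c) refl
      where
      by-safety : ∀ b → safe c ≡ b →
                  (if b then (ℤ.+ (3 * Oₖ c)) ℚ./ 7
                   else ℕ→ℚ (Aₖ c) ℚ.+ ⅓ ℚ.* sumℚ (map (λ k → ℕ→ℚ (Aₖ k) ℚ.- (ℤ.+ (3 * Oₖ k)) ℚ./ 7) (neighbours c)))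
                  ≡ ℕ→ℚ (if b then 9 * Oₖ c else 21 * Aₖ c + ∑ (neighbours c) surplus) ℚ.* ⅟₂₁
      by-safety true  _  = three-sevenths (Oₖ c)
      by-safety false dc = dangerous-B c dc

    A-scaled : ∀ c → ℕ→ℚ (Aₖ c) ≡ ℕ→ℚ (21 * Aₖ c) ℚ.* ⅟₂₁
    A-scaled c = trans (twenty-one (ℕ→ℚ (Aₖ c))) (cong (ℚ._* ⅟₂₁) (sym (ℕ→ℚ-* 21 (Aₖ c))))
      where
      open ℚ-Solver
      twenty-one : ∀ a → a ≡ (ℕ→ℚ 21 ℚ.* a) ℚ.* ⅟₂₁
      twenty-one = solve 1 (λ a → a := (con (ℕ→ℚ 21) :* a) :* con ⅟₂₁) refl

    total-bound : sumℚ (map (B ω col σ opt) cells) ℚ.≤ sumℚ (map (λ c → ℕ→ℚ (Aₖ c)) cells)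
    total-bound = subst₂ ℚ._≤_
      (sym (sumℚ-scaled cells (B ω col σ opt) scaledB ⅟₂₁ (λ c _ → B-scaled c)))
      (sym (sumℚ-scaled cells (λ c → ℕ→ℚ (Aₖ c)) (λ c → 21 * Aₖ c) ⅟₂₁ (λ c _ → A-scaled c)))
      (ℚP.*-monoʳ-≤-nonNeg ⅟₂₁ (ℕ→ℚ-mono (ℕP.≤-trans scaled-inequality (ℕP.≤-reflexive (sym (∑-* cells 21 Aₖ))))))

open import Defs
open import Data.Nat using (ℕ; _<_)
open import Data.Nat.Divisibility using (_∣_)
open import Data.Fin using (Fin)
open import Data.List using (List; map)
open import Data.List.Membership.Propositional using (_∈_)
open import Data.List.Relation.Unary.Unique.Propositional using (Unique)
open import Data.Rational using (_≤_)
open import Data.Nat.Divisibility using (divides)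
open import Data.Product using (_,_)
open CACOAnalysis using (module Charging)

lemma2 : (ω : ℕ) → 0 < ω → 7 ∣ ω →
    (col : Cell → Fin 3) → ProperColouring col →
    (σ : List Cell) → (opt : Assignment σ) → Optimal ω σ opt →
    (cells : List Cell) → Unique cells →
    (∀ c → c ∈ σ → c ∈ cells) →
    sumℚ (map (B ω col σ opt) cells) ≤ sumℚ (map (λ c → ℕ→ℚ (A ω col σ c)) cells)
lemma2 ω _ (divides t ω≡t*7) col _ σ opt (feasible , _) cells cells-unique cover =
  Charging.total-bound ω t ω≡t*7 col σ opt feasible cells cells-unique cover
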